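{- Let $n\geq 1$ and $b\geq 1$ be integers with $b$ odd. Then the set $R_n(b)$, listed in increasing Reflected Gray Code Order $\prec$, is a $3$-adjacent Gray code: any two consecutive sequences in this list differ in at most $3$ positions, and these positions are consecutive (adjacent) indices.
   Context: A restricted growth function of length $n$ is an integer sequence $s_1s_2\ldots s_n$ with $s_1=0$ and $0\leq s_{i+1}\leq \max\{s_j\}_{j=1}^{i}+1$ for all $1\leq i\leq n-1$; $R_n$ denotes the set of these. For an integer $b\geq 1$, $R_n(b)=\{s_1\ldots s_n\in R_n : \max_i s_i\leq b\}$. For integers $m\geq 2$, $n\geq 1$, the Reflected Gray Code Order $\prec$ on $\{0,1,\ldots,m-1\}^n$ is defined by: $s_1\ldots s_n\prec t_1\ldots t_n$ if there is $k$ with $s_i=t_i$ for $1\leq i\leq k-1$, $s_k\neq t_k$, and either $\sum_{i=1}^{k-1}s_i$ is even and $s_k<t_k$, or $\sum_{i=1}^{k-1}s_i$ is odd and $s_k>t_k$. (The relative order of two sequences does not depend on $m$; here $R_n(b)\subseteq\{0,\ldots,b\}^n$.) The Hamming distance between two equal-length sequences is the number of positions in which they differ. A list of equal-length sequences is a $d$-adjacent Gray code if consecutive sequences have Hamming distance at most $d$ and the positions in which they differ are adjacent. -}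

module Defs where

open import Data.Nat using (ℕ; zero; suc; _+_; _≤_; _<_; _⊔_)
open import Data.Nat.Properties using (_≟_)
open import Data.Nat.DivMod using (_%_)
open import Data.Fin using (Fin; toℕ)
open import Data.Vec using (Vec; []; _∷_; lookup)
open import Data.Product using (Σ; _×_; _,_; ∃)
open import Data.Sum using (_⊎_)
open import Relation.Nullary using (¬_)
open import Relation.Binary.PropositionalEquality using (_≡_; _≢_)

Even : ℕ → Set
Even m = m % 2 ≡ 0

Odd : ℕ → Set
Odd m = m % 2 ≡ 1

-- Sequences s₁…sₙ are vectors; position i (1-based in the paper) is the
-- index i-1 : Fin n here.

prefixSum : ∀ {n} → ℕ → Vec ℕ n → ℕ
prefixSum zero    _        = 0
prefixSum (suc k) []       = 0
prefixSum (suc k) (x ∷ xs) = x + prefixSum k xs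

prefixMax : ∀ {n} → ℕ → Vec ℕ n → ℕ
prefixMax zero    _        = 0
prefixMax (suc k) []       = 0
prefixMax (suc k) (x ∷ xs) = x ⊔ prefixMax k xs

IsRGF : ∀ {n} → Vec ℕ n → Set
IsRGF {n} s =
  (∀ (i : Fin n) → toℕ i ≡ 0 → lookup s i ≡ 0) ×
  (∀ (i : Fin n) → lookup s i ≤ suc (prefixMax (toℕ i) s))

InR : (n b : ℕ) → Vec ℕ n → Set
InR n b s = IsRGF s × (∀ (i : Fin n) → lookup s i ≤ b)

_≺_ : ∀ {n} → Vec ℕ n → Vec ℕ n → Set
_≺_ {n} s t = Σ (Fin n) λ k →
  (∀ (i : Fin n) → toℕ i < toℕ k → lookup s i ≡ lookup t i) ×
  ((Even (prefixSum (toℕ k) s) × lookup s k < lookup t k) ⊎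
   (Odd  (prefixSum (toℕ k) s) × lookup t k < lookup s k))

Consecutive : (n b : ℕ) → Vec ℕ n → Vec ℕ n → Set
Consecutive n b s t =
  InR n b s × InR n b t × s ≺ t ×
  (∀ (u : Vec ℕ n) → InR n b u → ¬ (s ≺ u × u ≺ t))

AdjacentClose : ∀ {n} → ℕ → Vec ℕ n → Vec ℕ n → Set
AdjacentClose {n} d s t =
  s ≡ t ⊎
  Σ ℕ λ i → Σ ℕ λ j → i ≤ j × suc j ≤ i + d ×
    (∀ (k : Fin n) → lookup s k ≢ lookup t k → i ≤ toℕ k × toℕ k ≤ j) ×
    (∀ (k : Fin n) → i ≤ toℕ k → toℕ k ≤ j → lookup s k ≢ lookup t k)

module Submission where

-- Because no valid sequence lies strictly between s and t:
--   * s_k and t_k are adjacent integers (else a value between them could be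
--     inserted at position k);
--   * after position k, s is ≺-greatest and t is ≺-least among valid
--     sequences with their prefixes, so both follow a greedy rule: an entry
--     is 0 when the prefix sum before it (shifted by 1 for t) is odd, and
--     the largest admissible value min(b, 1 + prefix maximum) when it is even.
-- For a greedy tail an odd prefix sum forces zeros from then on, and since b
-- is odd two consecutive even prefix sums after k+1 are impossible, so both
-- tails vanish from position k+3.  The greedy rule is deterministic, so if
-- s and t agree at position k+1 (where their shifted prefix sums have the
-- same parity) they also agree at k+2.  The differing positions thus form
-- one of [k,k], [k,k+1], [k,k+2].

open import Defs
open import Data.Nat
open import Data.Nat.Properties
open import Data.Nat.DivMod using (_%_; %-distribˡ-+; m%n<n; [m+n]%n≡m%n)
open import Data.Fin using (Fin; toℕ; fromℕ<) renaming (zero to fzero; suc to fsuc)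
open import Data.Fin.Properties using (toℕ<n; toℕ-fromℕ<)
open import Data.Vec using (Vec; []; _∷_; lookup; replicate)
open import Data.Product using (Σ; _×_; _,_; proj₁; proj₂)
open import Data.Sum using (_⊎_; inj₁; inj₂)
open import Data.Empty using (⊥; ⊥-elim)
open import Relation.Nullary using (¬_; Dec; yes; no)
open import Relation.Binary.PropositionalEquality
open import Relation.Binary using (tri<; tri≈; tri>)

_≡₂_ : ℕ → ℕ → Set
m ≡₂ n = m % 2 ≡ n % 2

≡₂-+ : ∀ a a′ c c′ → a ≡₂ a′ → c ≡₂ c′ → (a + c) ≡₂ (a′ + c′)
≡₂-+ a a′ c c′ p q = begin
  (a + c) % 2                 ≡⟨ %-distribˡ-+ a c 2 ⟩
  (a % 2 + c % 2) % 2         ≡⟨ cong₂ (λ u w → (u + w) % 2) p q ⟩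
  (a′ % 2 + c′ % 2) % 2       ≡⟨ %-distribˡ-+ a′ c′ 2 ⟨
  (a′ + c′) % 2               ∎
  where open ≡-Reasoning

≡₂-suc-suc : ∀ m → suc (suc m) ≡₂ m
≡₂-suc-suc m = trans (cong (_% 2) (+-comm 2 m)) ([m+n]%n≡m%n m 2)

even-or-odd : ∀ m → Even m ⊎ Odd m
even-or-odd m with m % 2 | m%n<n m 2
... | 0           | _                 = inj₁ refl
... | 1           | _                 = inj₂ refl
... | suc (suc _) | s≤s (s≤s ())

even-odd-exclusive : ∀ m → Even m → Odd m → ⊥
even-odd-exclusive m e o = 0≢1+n (trans (sym e) o)

even⇒odd-suc : ∀ m → Even m → Odd (suc m)
even⇒odd-suc m e = ≡₂-+ 1 1 m 0 refl e

even-suc⇒odd : ∀ m → Even (suc m) → Odd m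
even-suc⇒odd m e = trans (sym (≡₂-suc-suc m)) (≡₂-+ 1 1 (suc m) 0 refl e)

odd-suc⇒even : ∀ m → Odd (suc m) → Even m
odd-suc⇒even m o = trans (sym (≡₂-suc-suc m)) (≡₂-+ 1 1 (suc m) 1 refl o)

even-summand : ∀ a c → Even a → Even (a + c) → Even c
even-summand a c ea eac = trans (≡₂-+ 0 a c c (sym ea) refl) eac

neighbours-parity : ∀ P a c → c ≡ suc a ⊎ a ≡ suc c → (P + a) ≡₂ suc (P + c)
neighbours-parity P a c (inj₁ refl) =
  sym (trans (cong (λ z → suc z % 2) (+-suc P a)) (≡₂-suc-suc (P + a)))
neighbours-parity P a c (inj₂ refl) = cong (_% 2) (+-suc P c)

-- Entry i of x, or 0 beyond its end; indices are natural numbers from here on.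
at : ∀ {n} → Vec ℕ n → ℕ → ℕ
at []       _       = 0
at (x ∷ xs) zero    = x
at (x ∷ xs) (suc i) = at xs i

lookup≡at : ∀ {n} (x : Vec ℕ n) (i : Fin n) → lookup x i ≡ at x (toℕ i)
lookup≡at (a ∷ x) fzero    = refl
lookup≡at (a ∷ x) (fsuc i) = lookup≡at x i

at-fromℕ< : ∀ {n i} (x : Vec ℕ n) (i<n : i < n) → lookup x (fromℕ< i<n) ≡ at x i
at-fromℕ< x i<n = trans (lookup≡at x (fromℕ< i<n)) (cong (at x) (toℕ-fromℕ< i<n))

at-beyond : ∀ {n} (x : Vec ℕ n) i → n ≤ i → at x i ≡ 0
at-beyond []      i       _         = refl
at-beyond (a ∷ x) (suc i) (s≤s n≤i) = at-beyond x i n≤i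

prefixSum-suc : ∀ {n} (x : Vec ℕ n) k → prefixSum (suc k) x ≡ prefixSum k x + at x k
prefixSum-suc []      zero    = refl
prefixSum-suc []      (suc k) = refl
prefixSum-suc (a ∷ x) zero    = +-comm a 0
prefixSum-suc (a ∷ x) (suc k) = trans (cong (a +_) (prefixSum-suc x k)) (sym (+-assoc a _ _))

prefixMax-suc : ∀ {n} (x : Vec ℕ n) k → prefixMax (suc k) x ≡ prefixMax k x ⊔ at x k
prefixMax-suc []      zero    = refl
prefixMax-suc []      (suc k) = refl
prefixMax-suc (a ∷ x) zero    = ⊔-identityʳ a
prefixMax-suc (a ∷ x) (suc k) = trans (cong (a ⊔_) (prefixMax-suc x k)) (sym (⊔-assoc a _ _))

AgreeBelow : ∀ {n} → ℕ → Vec ℕ n → Vec ℕ n → Set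
AgreeBelow k x y = ∀ i → i < k → at x i ≡ at y i

prefixSum-cong : ∀ {n} {x y : Vec ℕ n} k → AgreeBelow k x y → prefixSum k x ≡ prefixSum k y
prefixSum-cong zero    _ = refl
prefixSum-cong {x = []}    {[]}    (suc k) _ = refl
prefixSum-cong {x = a ∷ x} {c ∷ y} (suc k) h =
  cong₂ _+_ (h 0 z<s) (prefixSum-cong k (λ i i<k → h (suc i) (s≤s i<k)))

prefixMax-cong : ∀ {n} {x y : Vec ℕ n} k → AgreeBelow k x y → prefixMax k x ≡ prefixMax k y
prefixMax-cong zero    _ = refl
prefixMax-cong {x = []}    {[]}    (suc k) _ = refl
prefixMax-cong {x = a ∷ x} {c ∷ y} (suc k) h =
  cong₂ _⊔_ (h 0 z<s) (prefixMax-cong k (λ i i<k → h (suc i) (s≤s i<k)))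

Admissible : ℕ → ℕ → ℕ → Set
Admissible b M v = v ≤ b × v ≤ suc M

cap : ℕ → ℕ → ℕ
cap b M = b ⊓ suc M

cap-admissible : ∀ b M → Admissible b M (cap b M)
cap-admissible b M = m⊓n≤m b (suc M) , m⊓n≤n b (suc M)

admissible⇒≤cap : ∀ {b M v} → Admissible b M v → v ≤ cap b M
admissible⇒≤cap (v≤b , v≤1+M) = ⊓-glb v≤b v≤1+M

admissible-≤ : ∀ {b M v w} → w ≤ v → Admissible b M v → Admissible b M w
admissible-≤ w≤v (v≤b , v≤1+M) = ≤-trans w≤v v≤b , ≤-trans w≤v v≤1+M

admissible-⊔ : ∀ {b M a c} → Admissible b M a → Admissible b M c → Admissible b M (a ⊔ c)
admissible-⊔ (a≤b , a≤1+M) (c≤b , c≤1+M) = ⊔-lub a≤b c≤b , ⊔-lub a≤1+M c≤1+M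

cap-even : ∀ {b} → Odd b → ∀ M → Even (cap b M) → cap b M ≡ suc M × suc M < b
cap-even {b} b-odd M ev with ⊓-sel b (suc M)
... | inj₁ cap≡b = ⊥-elim (even-odd-exclusive (cap b M) ev (subst Odd (sym cap≡b) b-odd))
... | inj₂ cap≡1+M =
  cap≡1+M , ≤∧≢⇒< (subst (_≤ b) cap≡1+M (m⊓n≤m b (suc M)))
                  (λ 1+M≡b → even-odd-exclusive b (subst Even (trans cap≡1+M 1+M≡b) ev) b-odd)

-- Membership in R_n(b), by natural-number index.
record Valid {n} (b : ℕ) (x : Vec ℕ n) : Set where
  field
    starts-at-zero : at x 0 ≡ 0
    admissible     : ∀ i → Admissible b (prefixMax i x) (at x i)
open Valid

valid-of-InR : ∀ {n b} {x : Vec ℕ n} → InR n b x → Valid b x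
valid-of-InR {n} {b} {x} ((zero-start , growth) , bounded) =
  record { starts-at-zero = start x zero-start ; admissible = entry }
  where
  start : ∀ {m} (y : Vec ℕ m) → (∀ (i : Fin m) → toℕ i ≡ 0 → lookup y i ≡ 0) → at y 0 ≡ 0
  start []      _ = refl
  start (a ∷ y) h = h fzero refl
  entry : ∀ i → Admissible b (prefixMax i x) (at x i)
  entry i with i <? n
  ... | no i≮n  = subst (Admissible b (prefixMax i x)) (sym (at-beyond x i (≮⇒≥ i≮n))) (z≤n , z≤n)
  ... | yes i<n =
    subst (_≤ b) (at-fromℕ< x i<n) (bounded (fromℕ< i<n)) ,
    subst₂ (λ v j → v ≤ suc (prefixMax j x)) (at-fromℕ< x i<n) (toℕ-fromℕ< i<n)
      (growth (fromℕ< i<n))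

InR-of-valid : ∀ {n b} {x : Vec ℕ n} → Valid b x → InR n b x
InR-of-valid {n} {b} {x} vx =
  ((λ i i≡0 → trans (lookup≡at x i) (trans (cong (at x) i≡0) (starts-at-zero vx))) ,
   (λ i → subst (_≤ suc (prefixMax (toℕ i) x)) (sym (lookup≡at x i))
            (proj₂ (admissible vx (toℕ i))))) ,
  (λ i → subst (_≤ b) (sym (lookup≡at x i)) (proj₁ (admissible vx (toℕ i))))

-- After a prefix with sum p, value a comes before value c at the next position.
Before : ℕ → ℕ → ℕ → Set
Before p a c = (Even p × a < c) ⊎ (Odd p × c < a)

before-distinct : ∀ p {a c} → Before p a c → a ≢ c
before-distinct p (inj₁ (_ , a<c)) = <⇒≢ a<c
before-distinct p (inj₂ (_ , c<a)) = ≢-sym (<⇒≢ c<a)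

before-suc : ∀ p {a c} → Before (suc p) a c → Before p c a
before-suc p (inj₁ (ev , a<c)) = inj₂ (even-suc⇒odd p ev , a<c)
before-suc p (inj₂ (od , c<a)) = inj₁ (odd-suc⇒even p od , c<a)

neighbours-if-nothing-between : ∀ p {a c} → Before p a c →
  (∀ v → v ≤ a ⊔ c → Before p a v → Before p v c → ⊥) → c ≡ suc a ⊎ a ≡ suc c
neighbours-if-nothing-between p {a} {c} (inj₁ (ev , a<c)) none =
  inj₁ (≤-antisym (≮⇒≥ λ 1+a<c →
           none (suc a) (≤-trans a<c (m≤n⊔m a c)) (inj₁ (ev , ≤-refl)) (inj₁ (ev , 1+a<c)))
         a<c)
neighbours-if-nothing-between p {a} {c} (inj₂ (od , c<a)) none =
  inj₂ (≤-antisym (≮⇒≥ λ 1+c<a →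
           none (suc c) (≤-trans c<a (m≤m⊔n a c)) (inj₂ (od , 1+c<a)) (inj₂ (od , ≤-refl)))
         c<a)

-- x ≺ y, decided at position k.
record PrecedesAt {n} (x y : Vec ℕ n) (k : ℕ) : Set where
  field
    in-range : k < n
    agree    : AgreeBelow k x y
    before   : Before (prefixSum k x) (at x k) (at y k)

≺⇒precedesAt : ∀ {n} {x y : Vec ℕ n} → x ≺ y → Σ ℕ (PrecedesAt x y)
≺⇒precedesAt {x = x} {y} (k , agr , bef) = toℕ k , record
  { in-range = toℕ<n k
  ; agree    = agree′
  ; before   = subst₂ (Before (prefixSum (toℕ k) x)) (lookup≡at x k) (lookup≡at y k) bef
  }
  where
  agree′ : AgreeBelow (toℕ k) x y
  agree′ i i<k = begin
    at x i                  ≡⟨ at-fromℕ< x i<n ⟨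
    lookup x (fromℕ< i<n)   ≡⟨ agr (fromℕ< i<n) (subst (_< toℕ k) (sym (toℕ-fromℕ< i<n)) i<k) ⟩
    lookup y (fromℕ< i<n)   ≡⟨ at-fromℕ< y i<n ⟩
    at y i                  ∎
    where
    open ≡-Reasoning
    i<n : i < _
    i<n = <-trans i<k (toℕ<n k)

precedesAt⇒≺ : ∀ {n} {x y : Vec ℕ n} {k} → PrecedesAt x y k → x ≺ y
precedesAt⇒≺ {x = x} {y} {k} prec =
  at-fin (fromℕ< (in-range prec)) (subst (PrecedesAt x y) (sym (toℕ-fromℕ< (in-range prec))) prec)
  where
  open PrecedesAt
  at-fin : ∀ f → PrecedesAt x y (toℕ f) → x ≺ y
  at-fin f p = f ,
    (λ i i<f → trans (lookup≡at x i) (trans (agree p (toℕ i) i<f) (sym (lookup≡at y i)))) ,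
    subst₂ (Before (prefixSum (toℕ f) x)) (sym (lookup≡at x f)) (sym (lookup≡at y f)) (before p)

precedes-congˡ : ∀ {n} {x x′ y : Vec ℕ n} {k} →
  AgreeBelow (suc k) x′ x → PrecedesAt x y k → PrecedesAt x′ y k
precedes-congˡ {x = x} {x′} {y} {k} h prec = record
  { in-range = in-range
  ; agree    = λ i i<k → trans (h i (m<n⇒m<1+n i<k)) (agree i i<k)
  ; before   = subst₂ (λ p a → Before p a (at y k))
                 (sym (prefixSum-cong k (λ i i<k → h i (m<n⇒m<1+n i<k)))) (sym (h k (n<1+n k))) before
  }
  where open PrecedesAt prec

precedes-congʳ : ∀ {n} {x y y′ : Vec ℕ n} {k} →
  AgreeBelow (suc k) y′ y → PrecedesAt x y k → PrecedesAt x y′ k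
precedes-congʳ {x = x} {k = k} h prec = record
  { in-range = in-range
  ; agree    = λ i i<k → trans (agree i i<k) (sym (h i (m<n⇒m<1+n i<k)))
  ; before   = subst (Before (prefixSum k x) (at x k)) (sym (h k (n<1+n k))) before
  }
  where open PrecedesAt prec

splice : ∀ {n} → Vec ℕ n → ℕ → ℕ → Vec ℕ n
splice []      _       _ = []
splice (a ∷ x) zero    v = v ∷ replicate _ 0
splice (a ∷ x) (suc j) v = a ∷ splice x j v

at-zeros : ∀ m i → at (replicate m 0) i ≡ 0
at-zeros zero    i       = refl
at-zeros (suc m) zero    = refl
at-zeros (suc m) (suc i) = at-zeros m i

splice-below : ∀ {n} (x : Vec ℕ n) j v → AgreeBelow j (splice x j v) x
splice-below []      j       v i       _         = refl
splice-below (a ∷ x) (suc j) v zero    _         = refl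
splice-below (a ∷ x) (suc j) v (suc i) (s≤s i<j) = splice-below x j v i i<j

splice-at : ∀ {n} (x : Vec ℕ n) j v → j < n → at (splice x j v) j ≡ v
splice-at (a ∷ x) zero    v _         = refl
splice-at (a ∷ x) (suc j) v (s≤s j<n) = splice-at x j v j<n

splice-at-≤ : ∀ {n} (x : Vec ℕ n) j v → at (splice x j v) j ≤ v
splice-at-≤ []      j       v = z≤n
splice-at-≤ (a ∷ x) zero    v = ≤-refl
splice-at-≤ (a ∷ x) (suc j) v = splice-at-≤ x j v

splice-above : ∀ {n} (x : Vec ℕ n) j v i → j < i → at (splice x j v) i ≡ 0
splice-above         []      j       v i       _         = refl
splice-above {suc m} (a ∷ x) zero    v (suc i) _         = at-zeros m i
splice-above         (a ∷ x) (suc j) v (suc i) (s≤s j<i) = splice-above x j v i j<i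

splice-valid : ∀ {n b} {x : Vec ℕ n} {j v} → Valid b x → 0 < j →
  Admissible b (prefixMax j x) v → Valid b (splice x j v)
splice-valid {b = b} {x} {j} {v} vx 0<j adm = record
  { starts-at-zero = trans (splice-below x j v 0 0<j) (starts-at-zero vx)
  ; admissible     = entry
  }
  where
  u : Vec ℕ _
  u = splice x j v
  same-max : ∀ i → i ≤ j → prefixMax i u ≡ prefixMax i x
  same-max i i≤j = prefixMax-cong i (λ p p<i → splice-below x j v p (<-≤-trans p<i i≤j))
  entry : ∀ i → Admissible b (prefixMax i u) (at u i)
  entry i with <-cmp i j
  ... | tri< i<j _ _ = subst₂ (Admissible b) (sym (same-max i (<⇒≤ i<j))) (sym (splice-below x j v i i<j))
                         (admissible vx i)
  ... | tri≈ _ refl _ = subst (λ M → Admissible b M (at u j)) (sym (same-max j ≤-refl))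
                          (admissible-≤ (splice-at-≤ x j v) adm)
  ... | tri> _ _ j<i = subst (Admissible b (prefixMax i u)) (sym (splice-above x j v i j<i)) (z≤n , z≤n)

precedes-splice : ∀ {n} {x y : Vec ℕ n} {j v} → j < n → AgreeBelow j y x →
  Before (prefixSum j y) (at y j) v → PrecedesAt y (splice x j v) j
precedes-splice {x = x} {y} {j} {v} j<n h bef = record
  { in-range = j<n
  ; agree    = λ i i<j → trans (h i i<j) (sym (splice-below x j v i i<j))
  ; before   = subst (Before (prefixSum j y) (at y j)) (sym (splice-at x j v j<n)) bef
  }

splice-precedes : ∀ {n} {x y : Vec ℕ n} {j v} → j < n → AgreeBelow j x y →
  Before (prefixSum j x) v (at y j) → PrecedesAt (splice x j v) y j
splice-precedes {x = x} {y} {j} {v} j<n h bef = record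
  { in-range = j<n
  ; agree    = λ i i<j → trans (splice-below x j v i i<j) (h i i<j)
  ; before   = subst₂ (λ p a → Before p a (at y j))
                 (sym (prefixSum-cong j (splice-below x j v))) (sym (splice-at x j v j<n)) bef
  }

-- After position k, no admissible change of a single entry of x moves x up in
-- the order whose prefix sums are shifted by e.
Greedy : ∀ {n} → ℕ → Vec ℕ n → ℕ → ℕ → Set
Greedy {n} b x e k = ∀ j v → k < j → j < n → Admissible b (prefixMax j x) v →
  ¬ Before (e + prefixSum j x) (at x j) v

record GreedyRule {n} (b : ℕ) (x : Vec ℕ n) (e k : ℕ) : Set where
  field
    on-even : ∀ j → k < j → j < n → Even (e + prefixSum j x) → at x j ≡ cap b (prefixMax j x)
    on-odd  : ∀ j → k < j → Odd (e + prefixSum j x) → at x j ≡ 0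

-- Comparing x_j with the cap (for an even sum) or with 0 (for an odd one)
-- shows that greediness forces exactly these values.
greedy-rule : ∀ {n b} {x : Vec ℕ n} {e k} → Valid b x → Greedy b x e k → GreedyRule b x e k
greedy-rule {n} {b} {x} {e} {k} vx greedy = record { on-even = on-even ; on-odd = on-odd }
  where
  on-even : ∀ j → k < j → j < n → Even (e + prefixSum j x) → at x j ≡ cap b (prefixMax j x)
  on-even j k<j j<n ev = ≤-antisym (admissible⇒≤cap (admissible vx j))
    (≮⇒≥ λ below-cap → greedy j _ k<j j<n (cap-admissible b _) (inj₁ (ev , below-cap)))
  on-odd : ∀ j → k < j → Odd (e + prefixSum j x) → at x j ≡ 0
  on-odd j k<j od with j <? n
  ... | no  j≮n = at-beyond x j (≮⇒≥ j≮n)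
  ... | yes j<n =
    n≤0⇒n≡0 (≮⇒≥ λ positive → greedy j 0 k<j j<n (z≤n , z≤n) (inj₂ (od , positive)))

module GreedyTail {n b : ℕ} (b-odd : Odd b) {x : Vec ℕ n} {e k : ℕ} (rule : GreedyRule b x e k) where
  open GreedyRule rule public

  Q : ℕ → ℕ
  Q j = e + prefixSum j x

  Q-suc : ∀ j → Q (suc j) ≡ Q j + at x j
  Q-suc j = trans (cong (e +_) (prefixSum-suc x j)) (sym (+-assoc e _ _))

  odd-persists : ∀ j → k < j → Odd (Q j) → Odd (Q (suc j))
  odd-persists j k<j od =
    trans (cong (_% 2) (Q-suc j)) (≡₂-+ (Q j) 1 (at x j) 0 od (cong (_% 2) (on-odd j k<j od)))

  odd-from : ∀ j → k < j → Odd (Q j) → ∀ d → Odd (Q (d + j))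
  odd-from j k<j od zero    = od
  odd-from j k<j od (suc d) = odd-persists (d + j) (<-≤-trans k<j (m≤n+m j d)) (odd-from j k<j od d)

  zeros-from : ∀ j → k < j → Odd (Q j) → ∀ i → j ≤ i → at x i ≡ 0
  zeros-from j k<j od i j≤i =
    on-odd i (<-≤-trans k<j j≤i) (subst (λ z → Odd (Q z)) (m∸n+n≡m j≤i) (odd-from j k<j od (i ∸ j)))

  even-after-new-max : ∀ j → k < j → j < n → Even (Q (suc j)) →
    Even (at x j) × prefixMax (suc j) x ≡ at x j × at x j < b
  even-after-new-max j k<j j<n ev with even-or-odd (Q j)
  ... | inj₂ od = ⊥-elim (even-odd-exclusive (Q (suc j)) ev (odd-persists j k<j od))
  ... | inj₁ eQ = ex , new-max , subst (_< b) (sym raised) (proj₂ capped)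
    where
    ex : Even (at x j)
    ex = even-summand (Q j) (at x j) eQ (trans (cong (_% 2) (sym (Q-suc j))) ev)
    capped : cap b (prefixMax j x) ≡ suc (prefixMax j x) × suc (prefixMax j x) < b
    capped = cap-even b-odd (prefixMax j x) (subst Even (on-even j k<j j<n eQ) ex)
    raised : at x j ≡ suc (prefixMax j x)
    raised = trans (on-even j k<j j<n eQ) (proj₁ capped)
    new-max : prefixMax (suc j) x ≡ at x j
    new-max = trans (prefixMax-suc x j) (m≤n⇒m⊔n≡n (subst (prefixMax j x ≤_) (sym raised) (n≤1+n _)))

  new-max-after-even : ∀ j → k < j → j < n → Even (Q (suc j)) → prefixMax (suc j) x ≡ at x j
  new-max-after-even j k<j j<n ev = proj₁ (proj₂ (even-after-new-max j k<j j<n ev))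

  no-two-evens : ∀ j → k < j → suc j < n → Even (Q (suc j)) → Odd (Q (suc (suc j)))
  no-two-evens j k<j 1+j<n ev = begin
    Q (suc (suc j)) % 2              ≡⟨ cong (_% 2) (Q-suc (suc j)) ⟩
    (Q (suc j) + at x (suc j)) % 2   ≡⟨ ≡₂-+ (Q (suc j)) 0 (at x (suc j)) (suc (at x j)) ev (cong (_% 2) next) ⟩
    suc (at x j) % 2                 ≡⟨ even⇒odd-suc (at x j) ex ⟩
    1                                ∎
    where
    open ≡-Reasoning
    facts : Even (at x j) × prefixMax (suc j) x ≡ at x j × at x j < b
    facts = even-after-new-max j k<j (<-trans (n<1+n j) 1+j<n) ev
    ex : Even (at x j)
    ex = proj₁ facts
    next : at x (suc j) ≡ suc (at x j)
    next = begin
      at x (suc j)                    ≡⟨ on-even (suc j) (m<n⇒m<1+n k<j) 1+j<n ev ⟩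
      cap b (prefixMax (suc j) x)     ≡⟨ cong (cap b) (proj₁ (proj₂ facts)) ⟩
      b ⊓ suc (at x j)                ≡⟨ m≥n⇒m⊓n≡n (proj₂ (proj₂ facts)) ⟩
      suc (at x j)                    ∎

  vanishes-beyond : ∀ i → 3 + k ≤ i → at x i ≡ 0
  vanishes-beyond i 3+k≤i with i <? n
  ... | no  i≮n = at-beyond x i (≮⇒≥ i≮n)
  ... | yes i<n with even-or-odd (Q (2 + k))
  ...   | inj₂ od = zeros-from (2 + k) (m<n+m k z<s) od i (≤-trans (n≤1+n _) 3+k≤i)
  ...   | inj₁ ev = zeros-from (3 + k) (m<n+m k z<s)
                      (no-two-evens (suc k) (n<1+n k) (<⇒≤ (≤-<-trans 3+k≤i i<n)) ev) i 3+k≤i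

module TwoTails {n b : ℕ} (b-odd : Odd b) {x y : Vec ℕ n} {e e′ k : ℕ}
                (rx : GreedyRule b x e k) (ry : GreedyRule b y e′ k) where
  module X = GreedyTail b-odd rx
  module Y = GreedyTail b-odd ry

  next-parity : ∀ j → X.Q j ≡₂ Y.Q j → at x j ≡ at y j → X.Q (suc j) ≡₂ Y.Q (suc j)
  next-parity j same-parity same-entry =
    trans (cong (_% 2) (X.Q-suc j))
      (trans (≡₂-+ (X.Q j) (Y.Q j) (at x j) (at y j) same-parity (cong (_% 2) same-entry))
        (cong (_% 2) (sym (Y.Q-suc j))))

  agree-next : ∀ j → k < j → X.Q j ≡₂ Y.Q j → at x j ≡ at y j → at x (suc j) ≡ at y (suc j)
  agree-next j k<j same-parity same-entry with suc j <? n | even-or-odd (X.Q (suc j))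
  ... | no 1+j≮n | _ = trans (at-beyond x _ (≮⇒≥ 1+j≮n)) (sym (at-beyond y _ (≮⇒≥ 1+j≮n)))
  ... | yes _ | inj₂ ox =
    trans (X.on-odd (suc j) (m<n⇒m<1+n k<j) ox)
      (sym (Y.on-odd (suc j) (m<n⇒m<1+n k<j) (trans (sym (next-parity j same-parity same-entry)) ox)))
  ... | yes 1+j<n | inj₁ ex = begin
      at x (suc j)                   ≡⟨ X.on-even (suc j) k<1+j 1+j<n ex ⟩
      cap b (prefixMax (suc j) x)    ≡⟨ cong (cap b) (X.new-max-after-even j k<j j<n ex) ⟩
      cap b (at x j)                 ≡⟨ cong (cap b) same-entry ⟩
      cap b (at y j)                 ≡⟨ cong (cap b) (Y.new-max-after-even j k<j j<n ey) ⟨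
      cap b (prefixMax (suc j) y)    ≡⟨ Y.on-even (suc j) k<1+j 1+j<n ey ⟨
      at y (suc j)                   ∎
    where
    open ≡-Reasoning
    k<1+j : k < suc j
    k<1+j = m<n⇒m<1+n k<j
    j<n : j < n
    j<n = <-trans (n<1+n j) 1+j<n
    ey : Even (Y.Q (suc j))
    ey = trans (sym (next-parity j same-parity same-entry)) ex

NothingBetween : ∀ {n} → ℕ → Vec ℕ n → Vec ℕ n → Set
NothingBetween b s t = ∀ u → Valid b u → ∀ {i j} → PrecedesAt s u i → PrecedesAt u t j → ⊥

module ConsecutiveAnalysis {n b : ℕ} {s t : Vec ℕ n} (vs : Valid b s) (vt : Valid b t)
                           {k : ℕ} (s≺t : PrecedesAt s t k) (gap : NothingBetween b s t) where
  open PrecedesAt s≺t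

  -- Both sequences start with 0, so they cannot first differ at position 0.
  k-positive : 0 < k
  k-positive = n≢0⇒n>0 λ k≡0 → before-distinct (prefixSum k s) before (begin
    at s k  ≡⟨ cong (at s) k≡0 ⟩
    at s 0  ≡⟨ starts-at-zero vs ⟩
    0       ≡⟨ starts-at-zero vt ⟨
    at t 0  ≡⟨ cong (at t) k≡0 ⟨
    at t k  ∎)
    where open ≡-Reasoning

  -- Otherwise a value strictly between s_k and t_k could be spliced in at k.
  neighbours-at-k : at t k ≡ suc (at s k) ⊎ at s k ≡ suc (at t k)
  neighbours-at-k = neighbours-if-nothing-between (prefixSum k s) before insert
    where
    insert : ∀ v → v ≤ at s k ⊔ at t k →
      Before (prefixSum k s) (at s k) v → Before (prefixSum k s) v (at t k) → ⊥
    insert v v≤ before-v v-before = gap (splice s k v) (splice-valid vs k-positive adm)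
      (precedes-splice in-range (λ _ _ → refl) before-v) (splice-precedes in-range agree v-before)
      where
      adm : Admissible b (prefixMax k s) v
      adm = admissible-≤ v≤ (admissible-⊔ (admissible vs k)
              (subst (λ M → Admissible b M (at t k)) (sym (prefixMax-cong k agree)) (admissible vt k)))

  -- s is the ≺-greatest valid sequence with its first k+1 entries.
  s-greedy : Greedy b s 0 k
  s-greedy j v k<j j<n adm rises = gap (splice s j v) (splice-valid vs (<-≤-trans z<s k<j) adm)
    (precedes-splice j<n (λ _ _ → refl) rises)
    (precedes-congˡ (λ i i≤k → splice-below s j v i (<-≤-trans i≤k k<j)) s≺t)

  -- t is the ≺-least valid sequence with its first k+1 entries.
  t-greedy : Greedy b t 1 k
  t-greedy j v k<j j<n adm falls = gap (splice t j v) (splice-valid vt (<-≤-trans z<s k<j) adm)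
    (precedes-congʳ (λ i i≤k → splice-below t j v i (<-≤-trans i≤k k<j)) s≺t)
    (splice-precedes j<n (λ _ _ → refl) (before-suc (prefixSum j t) falls))

  parities-agree : prefixSum (suc k) s ≡₂ (1 + prefixSum (suc k) t)
  parities-agree = subst₂ (λ u w → u ≡₂ suc w) (sym (prefixSum-suc s k)) (sym sum-t)
                     (neighbours-parity (prefixSum k s) (at s k) (at t k) neighbours-at-k)
    where
    sum-t : prefixSum (suc k) t ≡ prefixSum k s + at t k
    sum-t = trans (prefixSum-suc t k) (cong (_+ at t k) (sym (prefixSum-cong k agree)))

DifferExactlyOn : (ℕ → ℕ) → (ℕ → ℕ) → ℕ → ℕ → Set
DifferExactlyOn f g i j =
  (∀ p → f p ≢ g p → i ≤ p × p ≤ j) × (∀ p → i ≤ p → p ≤ j → f p ≢ g p)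

on-three : ∀ (P : ℕ → Set) {k p} → P k → P (1 + k) → P (2 + k) → k ≤ p → p ≤ 2 + k → P p
on-three P {zero}  {zero}                Pk _  _  _         _ = Pk
on-three P {zero}  {suc zero}            _  P1 _  _         _ = P1
on-three P {zero}  {suc (suc zero)}      _  _  P2 _         _ = P2
on-three P {zero}  {suc (suc (suc p))}   _  _  _  _         (s≤s (s≤s ()))
on-three P {suc k} {suc p}               Pk P1 P2 (s≤s k≤p) (s≤s p≤) =
  on-three (λ m → P (suc m)) Pk P1 P2 k≤p p≤

interval-of-three : ∀ (f g : ℕ → ℕ) k → f k ≢ g k → (∀ p → p < k → f p ≡ g p) →
  (∀ p → 3 + k ≤ p → f p ≡ g p) → (f (1 + k) ≡ g (1 + k) → f (2 + k) ≡ g (2 + k)) →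
  Σ ℕ λ j → k ≤ j × suc j ≤ k + 3 × DifferExactlyOn f g k j
interval-of-three f g k dk below above step = by-cases (f (2 + k) ≟ g (2 + k)) (f (1 + k) ≟ g (1 + k))
  where
  Differ : ℕ → Set
  Differ p = f p ≢ g p
  near : ∀ p → Differ p → k ≤ p × p ≤ 2 + k
  near p d = ≮⇒≥ (λ p<k → d (below p p<k)) , ≮⇒≥ (λ 2+k<p → d (above p 2+k<p))
  short : ∀ j → j ≤ 2 + k → suc j ≤ k + 3
  short j j≤ = subst (suc j ≤_) (+-comm 3 k) (s≤s j≤)
  by-cases : Dec (f (2 + k) ≡ g (2 + k)) → Dec (f (1 + k) ≡ g (1 + k)) →
    Σ ℕ λ j → k ≤ j × suc j ≤ k + 3 × DifferExactlyOn f g k j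
  by-cases (no d₂) _ =
    2 + k , m≤n+m k 2 , short _ ≤-refl , near ,
    λ p → on-three Differ dk (λ e₁ → d₂ (step e₁)) d₂
  by-cases (yes e₂) (no d₁) =
    1 + k , n≤1+n k , short _ (n≤1+n _) ,
    (λ p d → let (k≤p , p≤) = near p d in
      k≤p , on-three (λ p → Differ p → p ≤ 1 + k)
              (λ _ → n≤1+n k) (λ _ → ≤-refl) (λ d₂ → ⊥-elim (d₂ e₂)) k≤p p≤ d) ,
    (λ p k≤p p≤ → on-three (λ p → p ≤ 1 + k → Differ p)
                    (λ _ → dk) (λ _ → d₁) (λ le → ⊥-elim (1+n≰n le)) k≤p (≤-trans p≤ (n≤1+n _)) p≤)
  by-cases (yes e₂) (yes e₁) =
    k , ≤-refl , short _ (m≤n+m k 2) ,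
    (λ p d → let (k≤p , p≤) = near p d in
      k≤p , on-three (λ p → Differ p → p ≤ k)
              (λ _ → ≤-refl) (λ d₁ → ⊥-elim (d₁ e₁)) (λ d₂ → ⊥-elim (d₂ e₂)) k≤p p≤ d) ,
    (λ p k≤p p≤k → subst Differ (≤-antisym k≤p p≤k) dk)

consecutive-differences : ∀ {n b} → Odd b → {s t : Vec ℕ n} → Valid b s → Valid b t →
  ∀ {k} → PrecedesAt s t k → NothingBetween b s t →
  Σ ℕ λ j → k ≤ j × suc j ≤ k + 3 × DifferExactlyOn (at s) (at t) k j
consecutive-differences {n} {b} b-odd {s} {t} vs vt {k} s≺t gap =
  interval-of-three (at s) (at t) k (before-distinct (prefixSum k s) before) agree
    (λ p 3+k≤p → trans (S.vanishes-beyond p 3+k≤p) (sym (T.vanishes-beyond p 3+k≤p)))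
    (agree-next (1 + k) (n<1+n k) parities-agree)
  where
  open PrecedesAt s≺t
  open ConsecutiveAnalysis vs vt s≺t gap
  s-rule : GreedyRule b s 0 k
  s-rule = greedy-rule vs s-greedy
  t-rule : GreedyRule b t 1 k
  t-rule = greedy-rule vt t-greedy
  module S = GreedyTail b-odd s-rule
  module T = GreedyTail b-odd t-rule
  open TwoTails b-odd s-rule t-rule

interval-by-lookup : ∀ {n d} {s t : Vec ℕ n} {i} →
  (Σ ℕ λ j → i ≤ j × suc j ≤ i + d × DifferExactlyOn (at s) (at t) i j) →
  Σ ℕ λ i → Σ ℕ λ j → i ≤ j × suc j ≤ i + d ×
    (∀ (k : Fin n) → lookup s k ≢ lookup t k → i ≤ toℕ k × toℕ k ≤ j) ×
    (∀ (k : Fin n) → i ≤ toℕ k → toℕ k ≤ j → lookup s k ≢ lookup t k)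
interval-by-lookup {s = s} {t} {i} (j , i≤j , short , outside , inside) =
  i , j , i≤j , short ,
  (λ k d → outside (toℕ k) (λ e → d (trans (lookup≡at s k) (trans e (sym (lookup≡at t k)))))) ,
  (λ k i≤k k≤j e → inside (toℕ k) i≤k k≤j (trans (sym (lookup≡at s k)) (trans e (lookup≡at t k))))

theorem1 : (n b : ℕ) → 1 ≤ n → 1 ≤ b → Odd b →
    ∀ (s t : Vec ℕ n) → Consecutive n b s t → AdjacentClose 3 s t
theorem1 n b _ _ b-odd s t (s∈R , t∈R , s≺t , nothing-between) =
  inj₂ (interval-by-lookup {s = s} {t}
         (consecutive-differences b-odd (valid-of-InR s∈R) (valid-of-InR t∈R)
           (proj₂ (≺⇒precedesAt s≺t)) gap))
  where
  gap : NothingBetween b s t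
  gap u vu s≺u u≺t = nothing-between u (InR-of-valid vu) (precedesAt⇒≺ s≺u , precedesAt⇒≺ u≺t)
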